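{- Let $q\ge 1$ be an integer and let $(A,B,C,\mathcal{F})$ be an instance of 3-dimensional matching: $A,B,C$ are pairwise disjoint finite sets with $|A|=2q$ and $|B|=|C|=q$, and $\mathcal{F}\subseteq A\times B\times C$. Construct a hypergraph $H$ as follows. The drivers are the elements of $A$, each with capacity $2$; the riders are the elements of $B\cup C$. For every triple $f=(a,b,c)\in\mathcal{F}$, $H$ contains the hyperedges $\{a,b,c\}$, $\{a,b\}$ and $\{a,c\}$; in addition, for every $a\in A$ and $b\in B$, $\{a,b\}$ is an edge, and for every $a\in A$ and $c\in C$, $\{a,c\}$ is an edge. Every edge has weight $1$. Consider the integer linear program $$\min \sum_{e\in E(H)} x_e \quad\text{s.t.}\quad \sum_{e\ni a} x_e\le 1\ \ \forall a\in A,\qquad \sum_{e\ni r}x_e=1\ \ \forall r\in B\cup C,\qquad x_e\in\{0,1\}\ \ \forall e\in E(H).$$ Then $\mathcal{F}$ contains $q$ pairwise disjoint triples (a 3-dimensional matching of cardinality $q$) if and only if the optimal objective value of this integer linear program is $q$.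
   Context: Two triples of $\mathcal{F}$ are disjoint if they share no element. Each hyperedge of $H$ contains exactly one element of $A$ and one or two elements of $B\cup C$. -}

module Defs where

open import Data.Nat using (ℕ; zero; suc; _+_; _*_; _≤_)
open import Data.Fin using (Fin; zero; suc)
open import Data.Fin.Properties using (_≟_)
open import Data.Bool using (Bool; true; false; T; if_then_else_; _∧_)
open import Data.Unit using (tt)
open import Data.Product using (Σ; _×_; _,_)
open import Relation.Binary.PropositionalEquality using (_≡_; _≢_)
open import Relation.Nullary.Decidable using (⌊_⌋)

∑ : ∀ {n} → (Fin n → ℕ) → ℕ
∑ {zero}  f = 0
∑ {suc n} f = f zero + ∑ (λ i → f (suc i))

∑T : (b : Bool) → (T b → ℕ) → ℕ
∑T true  f = f tt
∑T false f = 0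

-- A 3DM instance with |A| = 2q, |B| = |C| = q:
-- A = Fin (2 * q), B = Fin q, C = Fin q (disjoint as they are tagged
-- separately below); F ⊆ A × B × C given by its (decidable) indicator.
Triples : ℕ → Set
Triples q = Fin (2 * q) → Fin q → Fin q → Bool

module _ (q : ℕ) (F : Triples q) where

  data Vertex : Set where
    vA : Fin (2 * q) → Vertex
    vB : Fin q → Vertex
    vC : Fin q → Vertex

  -- Hyperedges of H (as a set): {a,b,c} for (a,b,c) ∈ F,
  -- {a,b} for all a ∈ A, b ∈ B, and {a,c} for all a ∈ A, c ∈ C.
  -- (The pairs {a,b},{a,c} coming from triples of F are already among these.)
  data Edge : Set where
    eABC : (a : Fin (2 * q)) (b c : Fin q) → T (F a b c) → Edge
    eAB  : (a : Fin (2 * q)) (b : Fin q) → Edge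
    eAC  : (a : Fin (2 * q)) (c : Fin q) → Edge

  _∈ₑ_ : Vertex → Edge → Bool
  vA x ∈ₑ eABC a b c _ = ⌊ x ≟ a ⌋
  vB x ∈ₑ eABC a b c _ = ⌊ x ≟ b ⌋
  vC x ∈ₑ eABC a b c _ = ⌊ x ≟ c ⌋
  vA x ∈ₑ eAB a b = ⌊ x ≟ a ⌋
  vB x ∈ₑ eAB a b = ⌊ x ≟ b ⌋
  vC x ∈ₑ eAB a b = false
  vA x ∈ₑ eAC a c = ⌊ x ≟ a ⌋
  vB x ∈ₑ eAC a c = false
  vC x ∈ₑ eAC a c = ⌊ x ≟ c ⌋

  edgeSum : (Edge → ℕ) → ℕ
  edgeSum g =
      ∑ (λ a → ∑ (λ b → ∑ (λ c → ∑T (F a b c) (λ p → g (eABC a b c p)))))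
    + ∑ (λ a → ∑ (λ b → g (eAB a b)))
    + ∑ (λ a → ∑ (λ c → g (eAC a c)))

  load : (Edge → ℕ) → Vertex → ℕ
  load x v = edgeSum (λ e → if v ∈ₑ e then x e else 0)

  Feasible : (Edge → ℕ) → Set
  Feasible x =
      (∀ e → x e ≤ 1)
    × (∀ a → load x (vA a) ≤ 1)
    × (∀ b → load x (vB b) ≡ 1)
    × (∀ c → load x (vC c) ≡ 1)

  objective : (Edge → ℕ) → ℕ
  objective x = edgeSum x

  OptimalValue : ℕ → Set
  OptimalValue k =
      Σ (Edge → ℕ) (λ x → Feasible x × objective x ≡ k)
    × (∀ x → Feasible x → k ≤ objective x)

HasPerfect3DM : (q : ℕ) → Triples q → Set
HasPerfect3DM q F =
  Σ (Fin q → Fin (2 * q) × Fin q × Fin q) λ m →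
      (∀ i → let (a , b , c) = m i in T (F a b c))
    × (∀ i j → i ≢ j →
         let (a , b , c) = m i in
         let (a' , b' , c') = m j in
         a ≢ a' × b ≢ b' × c ≢ c')

-- Every feasible x covers each rider b exactly once, by a triple edge {a,b,c} or a
-- pair {a,b}; summing over B, the weight on these two kinds of edges is q, so the
-- optimum is at least q, with equality iff no pair {a,c} is used.  Summing the same
-- constraints over C then forces every b to be covered by a triple edge.  The chosen
-- triples form a matching: two of them through one driver would overload it, and two
-- through one c would cover c twice.  Conversely a perfect matching, used as a 0/1
-- vector on the triple edges, covers every rider once and every driver at most once.
module Submission where

open import Defs
open import Data.Nat using (ℕ; zero; suc; _+_; _*_; _≤_; _≥_; z≤n; s≤s)
open import Data.Nat.Properties
  using (≤-refl; ≤-reflexive; ≤-trans; <-irrefl; 1+n≰n; module ≤-Reasoning; m≤m+n; m≤n+m; +-mono-≤;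
         +-comm; +-identityʳ; +-cancelˡ-≡; n≤0⇒n≡0; +-commutativeSemigroup)
import Algebra.Properties.CommutativeSemigroup as CommutativeSemigroupProperties
open import Data.Fin using (Fin; zero; suc; punchOut)
open import Data.Fin.Properties using (_≟_; any?; suc-injective; punchOut-injective; injective⇒≤)
open import Data.Bool using (Bool; true; false; T; if_then_else_)
open import Data.Unit using (tt)
open import Data.Empty using (⊥-elim)
open import Data.Product using (∃; _,_; proj₁; proj₂)
open import Function.Bundles using (_⇔_; mk⇔)
open import Function.Definitions using (Injective)
open import Relation.Binary.PropositionalEquality
open import Relation.Nullary using (yes; no)
open import Relation.Nullary.Decidable using (⌊_⌋)

private
  variable
    m n : ℕ

∑-cong : {f g : Fin n → ℕ} → (∀ i → f i ≡ g i) → ∑ f ≡ ∑ g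
∑-cong {zero}  _ = refl
∑-cong {suc n} h = cong₂ _+_ (h zero) (∑-cong (λ i → h (suc i)))

∑-zero : {f : Fin n → ℕ} → (∀ i → f i ≡ 0) → ∑ f ≡ 0
∑-zero {zero}  _ = refl
∑-zero {suc n} h = cong₂ _+_ (h zero) (∑-zero (λ i → h (suc i)))

∑-const-1 : ∑ {n} (λ _ → 1) ≡ n
∑-const-1 {zero}  = refl
∑-const-1 {suc n} = cong suc (∑-const-1 {n})

∑-distrib-+ : (f g : Fin n → ℕ) → ∑ (λ i → f i + g i) ≡ ∑ f + ∑ g
∑-distrib-+ {zero}  f g = refl
∑-distrib-+ {suc n} f g = trans
  (cong (f zero + g zero +_) (∑-distrib-+ (λ i → f (suc i)) (λ i → g (suc i))))
  (interchange (f zero) (g zero) (∑ (λ i → f (suc i))) (∑ (λ i → g (suc i))))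
  where open CommutativeSemigroupProperties +-commutativeSemigroup using (interchange)

∑-swap : (f : Fin m → Fin n → ℕ) → ∑ (λ i → ∑ (λ j → f i j)) ≡ ∑ (λ j → ∑ (λ i → f i j))
∑-swap {zero} {n} f = sym (∑-zero {n} (λ _ → refl))
∑-swap {suc m} f = trans (cong (∑ (f zero) +_) (∑-swap (λ i → f (suc i))))
  (sym (∑-distrib-+ (f zero) (λ j → ∑ (λ i → f (suc i) j))))

∑-single : (f : Fin n → ℕ) (i : Fin n) → f i ≤ ∑ f
∑-single f zero    = m≤m+n _ _
∑-single f (suc i) = ≤-trans (∑-single (λ k → f (suc k)) i) (m≤n+m _ _)

∑-pair : (f : Fin n → ℕ) {i j : Fin n} → i ≢ j → f i + f j ≤ ∑ f
∑-pair f {zero}  {zero}  i≢j = ⊥-elim (i≢j refl)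
∑-pair f {zero}  {suc j} _   = +-mono-≤ ≤-refl (∑-single (λ k → f (suc k)) j)
∑-pair f {suc i} {zero}  _   = subst (_≤ ∑ f) (+-comm (f zero) (f (suc i)))
  (+-mono-≤ ≤-refl (∑-single (λ k → f (suc k)) i))
∑-pair f {suc i} {suc j} i≢j =
  ≤-trans (∑-pair (λ k → f (suc k)) (λ i≡j → i≢j (cong suc i≡j))) (m≤n+m _ _)

∑∑-pair : (f : Fin m → Fin n → ℕ) {i i′ : Fin m} → i ≢ i′ → ∀ j j′ →
          f i j + f i′ j′ ≤ ∑ (λ k → ∑ (f k))
∑∑-pair f i≢i′ j j′ =
  ≤-trans (+-mono-≤ (∑-single (f _) j) (∑-single (f _) j′)) (∑-pair (λ k → ∑ (f k)) i≢i′)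

∑≡0⇒≡0 : (f : Fin n → ℕ) → ∑ f ≡ 0 → ∀ i → f i ≡ 0
∑≡0⇒≡0 f ∑f≡0 i = n≤0⇒n≡0 (subst (f i ≤_) ∑f≡0 (∑-single f i))

∑-positive : (f : Fin n → ℕ) → 1 ≤ ∑ f → ∃ λ i → 1 ≤ f i
∑-positive {suc n} f h with f zero in eq
... | zero  = let (i , p) = ∑-positive (λ k → f (suc k)) h in suc i , p
... | suc _ = zero , subst (1 ≤_) (sym eq) (s≤s z≤n)

∑-supported : (f : Fin n → ℕ) (i : Fin n) → (∀ j → j ≢ i → f j ≡ 0) → ∑ f ≡ f i
∑-supported f zero h =
  trans (cong (f zero +_) (∑-zero (λ j → h (suc j) (λ ())))) (+-identityʳ _)
∑-supported f (suc i) h = trans (cong (_+ ∑ (λ k → f (suc k))) (h zero (λ ())))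
  (∑-supported (λ k → f (suc k)) i (λ j j≢i → h (suc j) (λ e → j≢i (suc-injective e))))

if-≤ : ∀ b v → (if b then v else 0) ≤ v
if-≤ true  v = ≤-refl
if-≤ false v = z≤n

if-≟-yes : {i j : Fin n} (v : ℕ) → i ≡ j → (if ⌊ i ≟ j ⌋ then v else 0) ≡ v
if-≟-yes {i = i} {j} v i≡j with i ≟ j
... | yes _   = refl
... | no  i≢j = ⊥-elim (i≢j i≡j)

if-≟-no : {i j : Fin n} (v : ℕ) → i ≢ j → (if ⌊ i ≟ j ⌋ then v else 0) ≡ 0
if-≟-no {i = i} {j} v i≢j with i ≟ j
... | yes i≡j = ⊥-elim (i≢j i≡j)
... | no  _   = refl

∑-if : ∀ b (f : Fin n → ℕ) → ∑ (λ i → if b then f i else 0) ≡ (if b then ∑ f else 0)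
∑-if true  f = refl
∑-if {n} false f = ∑-zero {n} (λ _ → refl)

∑-δ : (i : Fin n) (f : Fin n → ℕ) → ∑ (λ j → if ⌊ i ≟ j ⌋ then f j else 0) ≡ f i
∑-δ i f = trans (∑-supported _ i (λ j j≢i → if-≟-no _ (λ i≡j → j≢i (sym i≡j))))
                (if-≟-yes _ refl)

∑T-if : ∀ b d (f : T b → ℕ) → ∑T b (λ p → if d then f p else 0) ≡ (if d then ∑T b f else 0)
∑T-if true  d f = refl
∑T-if false true  f = refl
∑T-if false false f = refl

∑T-const : ∀ b {v} → T b → ∑T b (λ _ → v) ≡ v
∑T-const true _ = refl

∑T-zero : ∀ b → ∑T b (λ _ → 0) ≡ 0
∑T-zero true  = refl
∑T-zero false = refl

∑T-positive⇒T : ∀ b (f : T b → ℕ) → 1 ≤ ∑T b f → T b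
∑T-positive⇒T true f _ = tt

distinct⇒injective : {X : Set} {f : Fin n → X} → (∀ i j → i ≢ j → f i ≢ f j) → Injective _≡_ _≡_ f
distinct⇒injective {f = f} distinct {i} {j} fi≡fj with i ≟ j
... | yes i≡j = i≡j
... | no  i≢j = ⊥-elim (distinct i j i≢j fi≡fj)

-- An injection Fin (suc k) → Fin (suc k) missing b would give an injection into Fin k.
injective⇒surjective : {f : Fin n → Fin n} → Injective _≡_ _≡_ f → ∀ b → ∃ λ i → f i ≡ b
injective⇒surjective {suc k} {f} f-inj b with any? (λ i → f i ≟ b)
... | yes hit = hit
... | no miss = ⊥-elim (<-irrefl refl (injective⇒≤ {f = squeeze} squeeze-injective))
  where
  avoids : ∀ i → b ≢ f i
  avoids i b≡fi = miss (i , sym b≡fi)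
  squeeze : Fin (suc k) → Fin k
  squeeze i = punchOut (avoids i)
  squeeze-injective : Injective _≡_ _≡_ squeeze
  squeeze-injective {i} {j} e = f-inj (punchOut-injective (avoids i) (avoids j) e)

∑-fibre-hit : {g : Fin m → Fin n} → Injective _≡_ _≡_ g → ∀ {k} i → g i ≡ k →
              ∑ (λ j → if ⌊ g j ≟ k ⌋ then 1 else 0) ≡ 1
∑-fibre-hit g-inj i gi≡k = trans
  (∑-supported _ i (λ j j≢i → if-≟-no 1 (λ gj≡k → j≢i (g-inj (trans gj≡k (sym gi≡k))))))
  (if-≟-yes 1 gi≡k)

∑-fibre-≤1 : {g : Fin m → Fin n} → Injective _≡_ _≡_ g → ∀ k →
             ∑ (λ j → if ⌊ g j ≟ k ⌋ then 1 else 0) ≤ 1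
∑-fibre-≤1 {g = g} g-inj k with any? (λ j → g j ≟ k)
... | yes (i , gi≡k) = ≤-reflexive (∑-fibre-hit g-inj i gi≡k)
... | no  miss       = subst (_≤ 1) (sym (∑-zero (λ j → if-≟-no 1 (λ gj≡k → miss (j , gj≡k))))) z≤n

module Instance (q : ℕ) (F : Triples q) where

  A B C : Set
  A = Fin (2 * q)
  B = Fin q
  C = Fin q

  -- A perfect matching listed by its B-coordinate: b is matched with driver b and
  -- partner b ∈ C.
  record Matching : Set where
    field
      driver            : B → A
      partner           : B → C
      driver-injective  : Injective _≡_ _≡_ driver
      partner-injective : Injective _≡_ _≡_ partner
      triple∈F          : ∀ b → T (F (driver b) b (partner b))

  Matching⇒HasPerfect3DM : Matching → HasPerfect3DM q F
  Matching⇒HasPerfect3DM M =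
      (λ b → driver b , b , partner b)
    , triple∈F
    , λ b b′ b≢b′ → (λ e → b≢b′ (driver-injective e)) , b≢b′ , (λ e → b≢b′ (partner-injective e))
    where open Matching M

  HasPerfect3DM⇒Matching : HasPerfect3DM q F → Matching
  HasPerfect3DM⇒Matching (m , m∈F , disjoint) = record
    { driver            = λ b → α (σ b)
    ; partner           = λ b → γ (σ b)
    ; driver-injective  = λ e → σ-injective (α-injective e)
    ; partner-injective = λ e → σ-injective (γ-injective e)
    ; triple∈F          = λ b → subst (λ b′ → T (F (α (σ b)) b′ (γ (σ b)))) (βσ b) (m∈F (σ b))
    }
    where
    α : Fin q → A
    α i = proj₁ (m i)
    β : Fin q → B
    β i = proj₁ (proj₂ (m i))
    γ : Fin q → C
    γ i = proj₂ (proj₂ (m i))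
    α-injective : Injective _≡_ _≡_ α
    α-injective = distinct⇒injective (λ i j i≢j → proj₁ (disjoint i j i≢j))
    β-injective : Injective _≡_ _≡_ β
    β-injective = distinct⇒injective (λ i j i≢j → proj₁ (proj₂ (disjoint i j i≢j)))
    γ-injective : Injective _≡_ _≡_ γ
    γ-injective = distinct⇒injective (λ i j i≢j → proj₂ (proj₂ (disjoint i j i≢j)))
    σ : B → Fin q
    σ b = proj₁ (injective⇒surjective β-injective b)
    βσ : ∀ b → β (σ b) ≡ b
    βσ b = proj₂ (injective⇒surjective β-injective b)
    σ-injective : Injective _≡_ _≡_ σ
    σ-injective {b} {b′} e = trans (sym (βσ b)) (trans (cong β e) (βσ b′))

  tripleMass : (Edge q F → ℕ) → A → B → C → ℕ
  tripleMass x a b c = ∑T (F a b c) (λ p → x (eABC a b c p))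

  triples pairsAB pairsAC : (Edge q F → ℕ) → ℕ
  triples x = ∑ (λ a → ∑ (λ b → ∑ (tripleMass x a b)))
  pairsAB x = ∑ (λ a → ∑ (λ b → x (eAB a b)))
  pairsAC x = ∑ (λ a → ∑ (λ c → x (eAC a c)))

  -- Each incidence test is a guard  if ⌊ v ≟ _ ⌋; pull it out of the inner sums
  -- (∑-if, ∑T-if) and collapse the sum over the guarded coordinate with ∑-δ.
  load-vA : ∀ x a → load q F x (vA a) ≡
            ∑ (λ b → ∑ (tripleMass x a b)) + ∑ (λ b → x (eAB a b)) + ∑ (λ c → x (eAC a c))
  load-vA x a = cong₂ _+_ (cong₂ _+_ via-triples via-pairsAB) via-pairsAC
    where
    δ : A → Bool
    δ a′ = ⌊ a ≟ a′ ⌋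
    via-triples : ∑ (λ a′ → ∑ (λ b → ∑ (λ c →
                    ∑T (F a′ b c) (λ p → if δ a′ then x (eABC a′ b c p) else 0))))
                ≡ ∑ (λ b → ∑ (tripleMass x a b))
    via-triples = trans
      (∑-cong λ a′ → trans
        (∑-cong λ b → trans (∑-cong λ c → ∑T-if (F a′ b c) (δ a′) _) (∑-if (δ a′) (tripleMass x a′ b)))
        (∑-if (δ a′) (λ b → ∑ (tripleMass x a′ b))))
      (∑-δ a (λ a′ → ∑ (λ b → ∑ (tripleMass x a′ b))))
    via-pairsAB : ∑ (λ a′ → ∑ (λ b → if δ a′ then x (eAB a′ b) else 0)) ≡ ∑ (λ b → x (eAB a b))
    via-pairsAB = trans (∑-cong λ a′ → ∑-if (δ a′) (λ b → x (eAB a′ b)))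
                        (∑-δ a (λ a′ → ∑ (λ b → x (eAB a′ b))))
    via-pairsAC : ∑ (λ a′ → ∑ (λ c → if δ a′ then x (eAC a′ c) else 0)) ≡ ∑ (λ c → x (eAC a c))
    via-pairsAC = trans (∑-cong λ a′ → ∑-if (δ a′) (λ c → x (eAC a′ c)))
                        (∑-δ a (λ a′ → ∑ (λ c → x (eAC a′ c))))

  load-vB : ∀ x b → load q F x (vB b) ≡ ∑ (λ a → ∑ (λ c → tripleMass x a b c)) + ∑ (λ a → x (eAB a b))
  load-vB x b = trans (cong₂ _+_ (cong₂ _+_
      (∑-cong λ a → trans (∑-cong λ b′ → trans
                (∑-cong λ c → ∑T-if (F a b′ c) ⌊ b ≟ b′ ⌋ _) (∑-if ⌊ b ≟ b′ ⌋ (tripleMass x a b′)))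
                (∑-δ b (λ b′ → ∑ (tripleMass x a b′))))
      (∑-cong λ a → ∑-δ b (λ b′ → x (eAB a b′))))
      (∑-zero {2 * q} λ a → ∑-zero {q} λ c → refl))
    (+-identityʳ _)

  load-vC : ∀ x c → load q F x (vC c) ≡ ∑ (λ a → ∑ (λ b → tripleMass x a b c)) + ∑ (λ a → x (eAC a c))
  load-vC x c = trans (cong₂ _+_ (cong₂ _+_
      (∑-cong λ a → ∑-cong λ b → trans
                (∑-cong λ c′ → ∑T-if (F a b c′) ⌊ c ≟ c′ ⌋ _) (∑-δ c (tripleMass x a b)))
      (∑-zero {2 * q} λ a → ∑-zero {q} λ b → refl))
      (∑-cong λ a → ∑-δ c (λ c′ → x (eAC a c′))))
    (cong (_+ ∑ (λ a → x (eAC a c))) (+-identityʳ _))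

  ∑-load-vB : ∀ x → ∑ (λ b → load q F x (vB b)) ≡ triples x + pairsAB x
  ∑-load-vB x = begin
    ∑ (λ b → load q F x (vB b))
      ≡⟨ ∑-cong (load-vB x) ⟩
    ∑ (λ b → ∑ (λ a → ∑ (tripleMass x a b)) + ∑ (λ a → x (eAB a b)))
      ≡⟨ ∑-distrib-+ (λ b → ∑ (λ a → ∑ (tripleMass x a b))) (λ b → ∑ (λ a → x (eAB a b))) ⟩
    ∑ (λ b → ∑ (λ a → ∑ (tripleMass x a b))) + ∑ (λ b → ∑ (λ a → x (eAB a b)))
      ≡⟨ cong₂ _+_ (∑-swap (λ b a → ∑ (tripleMass x a b))) (∑-swap (λ b a → x (eAB a b))) ⟩
    triples x + pairsAB x ∎
    where open ≡-Reasoning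

  ∑-load-vC : ∀ x → ∑ (λ c → load q F x (vC c)) ≡ triples x + pairsAC x
  ∑-load-vC x = begin
    ∑ (λ c → load q F x (vC c))
      ≡⟨ ∑-cong (load-vC x) ⟩
    ∑ (λ c → ∑ (λ a → ∑ (λ b → tripleMass x a b c)) + ∑ (λ a → x (eAC a c)))
      ≡⟨ ∑-distrib-+ (λ c → ∑ (λ a → ∑ (λ b → tripleMass x a b c))) (λ c → ∑ (λ a → x (eAC a c))) ⟩
    ∑ (λ c → ∑ (λ a → ∑ (λ b → tripleMass x a b c))) + ∑ (λ c → ∑ (λ a → x (eAC a c)))
      ≡⟨ cong₂ _+_ (trans (∑-swap (λ c a → ∑ (λ b → tripleMass x a b c)))
                          (∑-cong λ a → ∑-swap (λ c b → tripleMass x a b c)))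
                   (∑-swap (λ c a → x (eAC a c))) ⟩
    triples x + pairsAC x ∎
    where open ≡-Reasoning

  module _ {x : Edge q F → ℕ} (feasible : Feasible q F x) where

    private
      capacity-vA : ∀ a → load q F x (vA a) ≤ 1
      capacity-vA = proj₁ (proj₂ feasible)
      covered-vB : ∀ b → load q F x (vB b) ≡ 1
      covered-vB = proj₁ (proj₂ (proj₂ feasible))
      covered-vC : ∀ c → load q F x (vC c) ≡ 1
      covered-vC = proj₂ (proj₂ (proj₂ feasible))

    triples+pairsAB≡q : triples x + pairsAB x ≡ q
    triples+pairsAB≡q = trans (sym (∑-load-vB x)) (trans (∑-cong covered-vB) ∑-const-1)

    triples+pairsAC≡q : triples x + pairsAC x ≡ q
    triples+pairsAC≡q = trans (sym (∑-load-vC x)) (trans (∑-cong covered-vC) ∑-const-1)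

    objective-feasible : objective q F x ≡ q + pairsAC x
    objective-feasible = cong (_+ pairsAC x) triples+pairsAB≡q

    objective-lower-bound : q ≤ objective q F x
    objective-lower-bound = subst (q ≤_) (sym objective-feasible) (m≤m+n q (pairsAC x))

    module Optimal (optimal : objective q F x ≡ q) where

      pairsAC≡0 : pairsAC x ≡ 0
      pairsAC≡0 = +-cancelˡ-≡ q (pairsAC x) 0
        (trans (sym objective-feasible) (trans optimal (sym (+-identityʳ q))))

      triples≡q : triples x ≡ q
      triples≡q = trans (sym (+-identityʳ _))
        (trans (cong (triples x +_) (sym pairsAC≡0)) triples+pairsAC≡q)

      pairsAB≡0 : pairsAB x ≡ 0
      pairsAB≡0 = +-cancelˡ-≡ (triples x) (pairsAB x) 0
        (trans triples+pairsAB≡q (trans (sym triples≡q) (sym (+-identityʳ _))))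

      triple-load-vB : ∀ b → ∑ (λ a → ∑ (λ c → tripleMass x a b c)) ≡ 1
      triple-load-vB b = begin
        ∑ (λ a → ∑ (tripleMass x a b))
          ≡⟨ +-identityʳ _ ⟨
        ∑ (λ a → ∑ (tripleMass x a b)) + 0
          ≡⟨ cong (∑ (λ a → ∑ (tripleMass x a b)) +_) pairs-at-b≡0 ⟨
        ∑ (λ a → ∑ (tripleMass x a b)) + ∑ (λ a → x (eAB a b))
          ≡⟨ load-vB x b ⟨
        load q F x (vB b)
          ≡⟨ covered-vB b ⟩
        1 ∎
        where
        open ≡-Reasoning
        pairs-at-b≡0 : ∑ (λ a → x (eAB a b)) ≡ 0
        pairs-at-b≡0 = ∑≡0⇒≡0 (λ b′ → ∑ (λ a → x (eAB a b′)))
          (trans (sym (∑-swap (λ a b′ → x (eAB a b′)))) pairsAB≡0) b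

      covering-triple : ∀ b → ∃ λ a → ∃ λ c → 1 ≤ tripleMass x a b c
      covering-triple b =
        let (a , pos) = ∑-positive _ (≤-reflexive (sym (triple-load-vB b)))
        in  a , ∑-positive _ pos

      driver : B → A
      driver b = proj₁ (covering-triple b)

      partner : B → C
      partner b = proj₁ (proj₂ (covering-triple b))

      chosen-positive : ∀ b → 1 ≤ tripleMass x (driver b) b (partner b)
      chosen-positive b = proj₂ (proj₂ (covering-triple b))

      drivers-distinct : ∀ b b′ → b ≢ b′ → driver b ≢ driver b′
      drivers-distinct b b′ b≢b′ same = 1+n≰n (begin
        2
          ≤⟨ +-mono-≤ (chosen-positive b) second ⟩
        tripleMass x a b (partner b) + tripleMass x a b′ (partner b′)
          ≤⟨ ∑∑-pair (tripleMass x a) b≢b′ _ _ ⟩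
        ∑ (λ b″ → ∑ (tripleMass x a b″))
          ≤⟨ m≤m+n _ _ ⟩
        ∑ (λ b″ → ∑ (tripleMass x a b″)) + ∑ (λ b″ → x (eAB a b″))
          ≤⟨ m≤m+n _ _ ⟩
        _
          ≡⟨ load-vA x a ⟨
        load q F x (vA a)
          ≤⟨ capacity-vA a ⟩
        1 ∎)
        where
        open ≤-Reasoning
        a : A
        a = driver b
        second : 1 ≤ tripleMass x a b′ (partner b′)
        second = subst (λ a′ → 1 ≤ tripleMass x a′ b′ (partner b′)) (sym same) (chosen-positive b′)

      partners-distinct : ∀ b b′ → b ≢ b′ → partner b ≢ partner b′
      partners-distinct b b′ b≢b′ same = 1+n≰n (begin
        2
          ≤⟨ +-mono-≤ (chosen-positive b) second ⟩
        tripleMass x (driver b) b c + tripleMass x (driver b′) b′ c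
          ≤⟨ ∑∑-pair (λ b″ a → tripleMass x a b″ c) b≢b′ _ _ ⟩
        ∑ (λ b″ → ∑ (λ a → tripleMass x a b″ c))
          ≡⟨ ∑-swap (λ a b″ → tripleMass x a b″ c) ⟨
        ∑ (λ a → ∑ (λ b″ → tripleMass x a b″ c))
          ≤⟨ m≤m+n _ _ ⟩
        ∑ (λ a → ∑ (λ b″ → tripleMass x a b″ c)) + ∑ (λ a → x (eAC a c))
          ≡⟨ load-vC x c ⟨
        load q F x (vC c)
          ≡⟨ covered-vC c ⟩
        1 ∎)
        where
        open ≤-Reasoning
        c : C
        c = partner b
        second : 1 ≤ tripleMass x (driver b′) b′ c
        second = subst (λ c′ → 1 ≤ tripleMass x (driver b′) b′ c′) (sym same) (chosen-positive b′)

      matching : Matching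
      matching = record
        { driver            = driver
        ; partner           = partner
        ; driver-injective  = distinct⇒injective drivers-distinct
        ; partner-injective = distinct⇒injective partners-distinct
        ; triple∈F          = λ b → ∑T-positive⇒T (F (driver b) b (partner b)) _ (chosen-positive b)
        }

  module MatchingSolution (M : Matching) where
    open Matching M

    selected : B → A → C → ℕ
    selected b a c = if ⌊ driver b ≟ a ⌋ then (if ⌊ partner b ≟ c ⌋ then 1 else 0) else 0

    x : Edge q F → ℕ
    x (eABC a b c _) = selected b a c
    x (eAB _ _)      = 0
    x (eAC _ _)      = 0

    tripleMass-x : ∀ a b c → tripleMass x a b c ≡ selected b a c
    tripleMass-x a b c with driver b ≟ a | partner b ≟ c
    ... | yes refl | yes refl = ∑T-const (F a b c) (triple∈F b)
    ... | yes _    | no _     = ∑T-zero (F a b c)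
    ... | no _     | _        = ∑T-zero (F a b c)

    ∑-selected : ∀ b a → ∑ (λ c → tripleMass x a b c) ≡ (if ⌊ driver b ≟ a ⌋ then 1 else 0)
    ∑-selected b a = trans (∑-cong (tripleMass-x a b))
      (trans (∑-if ⌊ driver b ≟ a ⌋ (λ c → if ⌊ partner b ≟ c ⌋ then 1 else 0))
             (cong (if ⌊ driver b ≟ a ⌋ then_else 0) (∑-δ (partner b) (λ _ → 1))))

    x≤1 : ∀ e → x e ≤ 1
    x≤1 (eABC a b c _) = ≤-trans (if-≤ ⌊ driver b ≟ a ⌋ _) (if-≤ ⌊ partner b ≟ c ⌋ 1)
    x≤1 (eAB _ _)      = z≤n
    x≤1 (eAC _ _)      = z≤n

    load-vA≤1 : ∀ a → load q F x (vA a) ≤ 1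
    load-vA≤1 a = begin
      load q F x (vA a)
        ≡⟨ load-vA x a ⟩
      ∑ (λ b → ∑ (tripleMass x a b)) + ∑ {q} (λ _ → 0) + ∑ {q} (λ _ → 0)
        ≡⟨ cong₂ (λ s t → ∑ (λ b → ∑ (tripleMass x a b)) + s + t)
                 (∑-zero {q} λ _ → refl) (∑-zero {q} λ _ → refl) ⟩
      ∑ (λ b → ∑ (tripleMass x a b)) + 0 + 0
        ≡⟨ trans (+-identityʳ _) (+-identityʳ _) ⟩
      ∑ (λ b → ∑ (tripleMass x a b))
        ≡⟨ ∑-cong (λ b → ∑-selected b a) ⟩
      ∑ (λ b → if ⌊ driver b ≟ a ⌋ then 1 else 0)
        ≤⟨ ∑-fibre-≤1 driver-injective a ⟩
      1 ∎
      where open ≤-Reasoning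

    load-vB≡1 : ∀ b → load q F x (vB b) ≡ 1
    load-vB≡1 b = begin
      load q F x (vB b)
        ≡⟨ load-vB x b ⟩
      ∑ (λ a → ∑ (λ c → tripleMass x a b c)) + ∑ {2 * q} (λ _ → 0)
        ≡⟨ cong₂ _+_ (∑-cong (∑-selected b)) (∑-zero {2 * q} λ _ → refl) ⟩
      ∑ (λ a → if ⌊ driver b ≟ a ⌋ then 1 else 0) + 0
        ≡⟨ cong (_+ 0) (∑-δ (driver b) (λ _ → 1)) ⟩
      1 ∎
      where open ≡-Reasoning

    load-vC≡1 : ∀ c → load q F x (vC c) ≡ 1
    load-vC≡1 c = begin
      load q F x (vC c)
        ≡⟨ load-vC x c ⟩
      ∑ (λ a → ∑ (λ b → tripleMass x a b c)) + ∑ {2 * q} (λ _ → 0)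
        ≡⟨ cong₂ _+_ (∑-cong λ a → ∑-cong λ b → tripleMass-x a b c) (∑-zero {2 * q} λ _ → refl) ⟩
      ∑ (λ a → ∑ (λ b → selected b a c)) + 0
        ≡⟨ +-identityʳ _ ⟩
      ∑ (λ a → ∑ (λ b → selected b a c))
        ≡⟨ ∑-swap (λ a b → selected b a c) ⟩
      ∑ (λ b → ∑ (λ a → selected b a c))
        ≡⟨ ∑-cong (λ b → ∑-δ (driver b) (λ _ → if ⌊ partner b ≟ c ⌋ then 1 else 0)) ⟩
      ∑ (λ b → if ⌊ partner b ≟ c ⌋ then 1 else 0)
        ≡⟨ ∑-fibre-hit partner-injective b₀ partner-b₀≡c ⟩
      1 ∎
      where
      open ≡-Reasoning
      b₀ : B
      b₀ = proj₁ (injective⇒surjective partner-injective c)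
      partner-b₀≡c : partner b₀ ≡ c
      partner-b₀≡c = proj₂ (injective⇒surjective partner-injective c)

    feasible : Feasible q F x
    feasible = x≤1 , load-vA≤1 , load-vB≡1 , load-vC≡1

    objective≡q : objective q F x ≡ q
    objective≡q = trans (objective-feasible feasible)
      (trans (cong (q +_) (∑-zero {2 * q} λ _ → ∑-zero {q} λ _ → refl)) (+-identityʳ q))

lemma2 : (q : ℕ) → q ≥ 1 → (F : Triples q) →
    HasPerfect3DM q F ⇔ OptimalValue q F q
lemma2 q _ F = mk⇔
  (λ perfect → let open MatchingSolution (HasPerfect3DM⇒Matching perfect) in
     (x , feasible , objective≡q) , λ _ → objective-lower-bound)
  (λ { ((x , feasible , optimal) , _) →
     Matching⇒HasPerfect3DM (Optimal.matching feasible optimal) })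
  where open Instance q F
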